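{- Let $G$ be a connected simple graph and let $e=uv\in E(G)$ be an edge that is not a bridge of $G$. Then $$\chi_{dom}(G)-1\leq \chi_{dom}(G-e)\leq \chi_{dom}(G)+2.$$
   Context: A dominated coloring of a simple graph $H$ is a proper vertex coloring of $H$ such that every color class is dominated by at least one vertex, i.e. for each color class $C$ there is a vertex $x$ of $H$ adjacent to every vertex of $C$. The dominated chromatic number $\chi_{dom}(H)$ is the minimum number of colors in a dominated coloring of $H$. $G-e$ denotes the graph obtained from $G$ by deleting the edge $e$ (keeping all vertices). -}

module Defs where

open import Data.Nat using (ℕ; _<_)
open import Data.Fin using (Fin)
open import Data.Bool using (Bool; true; false; _∧_; not)
open import Data.List using (List; []; _∷_)
open import Data.Product using (Σ; ∃; _×_; _,_)
open import Relation.Binary.PropositionalEquality using (_≡_)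
open import Relation.Nullary using (¬_; Dec; does)
open import Data.Fin.Properties using (_≟_)

record SimpleGraph (n : ℕ) : Set where
  field
    Adj    : Fin n → Fin n → Bool
    sym    : ∀ x y → Adj x y ≡ Adj y x
    irrefl : ∀ x → Adj x x ≡ false
open SimpleGraph public

Adjacent : ∀ {n} → SimpleGraph n → Fin n → Fin n → Set
Adjacent G x y = Adj G x y ≡ true

data Walk {n} (G : SimpleGraph n) : Fin n → Fin n → Set where
  here : ∀ {x} → Walk G x x
  step : ∀ {x y z} → Adjacent G x y → Walk G y z → Walk G x z

Connected : ∀ {n} → SimpleGraph n → Set
Connected G = ∀ x y → Walk G x y

samePair : ∀ {n} → Fin n → Fin n → Fin n → Fin n → Bool
samePair u v x y with does (u ≟ x) | does (v ≟ y) | does (u ≟ y) | does (v ≟ x)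
... | true | true | _ | _ = true
... | _ | _ | true | true = true
... | _ | _ | _ | _ = false

deleteEdge : ∀ {n} → SimpleGraph n → Fin n → Fin n → SimpleGraph n
deleteEdge {n} G u v = record
  { Adj = λ x y → Adj G x y ∧ not (samePair u v x y)
  ; sym = symP
  ; irrefl = λ x → irr x
  }
  where
  open import Relation.Binary.PropositionalEquality using (cong₂; refl)
  sp-sym : ∀ x y → samePair u v x y ≡ samePair u v y x
  sp-sym x y with u ≟ x | v ≟ y | u ≟ y | v ≟ x
  ... | Relation.Nullary.yes _ | Relation.Nullary.yes _ | Relation.Nullary.yes _ | Relation.Nullary.yes _ = refl
  ... | Relation.Nullary.yes _ | Relation.Nullary.yes _ | Relation.Nullary.yes _ | Relation.Nullary.no _ = refl
  ... | Relation.Nullary.yes _ | Relation.Nullary.yes _ | Relation.Nullary.no _ | Relation.Nullary.yes _ = refl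
  ... | Relation.Nullary.yes _ | Relation.Nullary.yes _ | Relation.Nullary.no _ | Relation.Nullary.no _ = refl
  ... | Relation.Nullary.yes _ | Relation.Nullary.no _ | Relation.Nullary.yes _ | Relation.Nullary.yes _ = refl
  ... | Relation.Nullary.yes _ | Relation.Nullary.no _ | Relation.Nullary.yes _ | Relation.Nullary.no _ = refl
  ... | Relation.Nullary.yes _ | Relation.Nullary.no _ | Relation.Nullary.no _ | Relation.Nullary.yes _ = refl
  ... | Relation.Nullary.yes _ | Relation.Nullary.no _ | Relation.Nullary.no _ | Relation.Nullary.no _ = refl
  ... | Relation.Nullary.no _ | Relation.Nullary.yes _ | Relation.Nullary.yes _ | Relation.Nullary.yes _ = refl
  ... | Relation.Nullary.no _ | Relation.Nullary.yes _ | Relation.Nullary.yes _ | Relation.Nullary.no _ = refl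
  ... | Relation.Nullary.no _ | Relation.Nullary.yes _ | Relation.Nullary.no _ | Relation.Nullary.yes _ = refl
  ... | Relation.Nullary.no _ | Relation.Nullary.yes _ | Relation.Nullary.no _ | Relation.Nullary.no _ = refl
  ... | Relation.Nullary.no _ | Relation.Nullary.no _ | Relation.Nullary.yes _ | Relation.Nullary.yes _ = refl
  ... | Relation.Nullary.no _ | Relation.Nullary.no _ | Relation.Nullary.yes _ | Relation.Nullary.no _ = refl
  ... | Relation.Nullary.no _ | Relation.Nullary.no _ | Relation.Nullary.no _ | Relation.Nullary.yes _ = refl
  ... | Relation.Nullary.no _ | Relation.Nullary.no _ | Relation.Nullary.no _ | Relation.Nullary.no _ = refl
  symP : ∀ x y → (Adj G x y ∧ not (samePair u v x y)) ≡ (Adj G y x ∧ not (samePair u v y x))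
  symP x y = cong₂ (λ a b → a ∧ not b) (SimpleGraph.sym G x y) (sp-sym x y)
  irr : ∀ x → (Adj G x x ∧ not (samePair u v x x)) ≡ false
  irr x rewrite SimpleGraph.irrefl G x = refl

Proper : ∀ {n k} → SimpleGraph n → (Fin n → Fin k) → Set
Proper G c = ∀ x y → Adjacent G x y → ¬ (c x ≡ c y)

AllClassesDominated : ∀ {n k} → SimpleGraph n → (Fin n → Fin k) → Set
AllClassesDominated {n} {k} G c = ∀ (i : Fin k) → Σ (Fin n) λ d → ∀ x → c x ≡ i → Adjacent G d x

DominatedColoring : ∀ {n} → SimpleGraph n → (k : ℕ) → Set
DominatedColoring {n} G k = Σ (Fin n → Fin k) λ c → Proper G c × AllClassesDominated G c

IsDomChromaticNumber : ∀ {n} → SimpleGraph n → ℕ → Set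
IsDomChromaticNumber G m = DominatedColoring G m × (∀ k → k < m → ¬ DominatedColoring G k)

module Submission where

-- Both bounds come from one recolouring principle.  Call a colouring of G
-- valid away from a list xs of exceptional vertices if it is proper on the
-- edges avoiding xs and every colour class, restricted to the vertices outside
-- xs, is dominated.  If an exceptional vertex u has a neighbour w, giving u a
-- brand-new colour removes u from the exceptions: its singleton class is
-- dominated by w.  Iterating, a colouring with k colours that is valid away
-- from xs (all of whose vertices have neighbours) yields a genuine dominated
-- colouring with |xs| + k colours.
--   * A dominated colouring of G - e is valid in G away from [u], since every
--     edge of G avoiding u survives in G - e; hence χ(G) ≤ χ(G - e) + 1.
--   * A dominated colouring of G is valid in G - e away from [u , v], since
--     every edge of G at a vertex outside {u , v} survives; u and v keep
--     neighbours in G - e because G - e is connected; hence χ(G - e) ≤ χ(G) + 2.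

open import Defs
open import Data.Nat using (ℕ; suc; _≤_; _+_)
open import Data.Nat.Properties using (≮⇒≥; +-comm; +-suc)
open import Data.Fin using (Fin; zero; suc)
open import Data.Fin.Properties using (_≟_; suc-injective)
open import Data.List using (List; []; _∷_; [_]; length)
open import Data.List.Membership.Propositional using (_∉_)
open import Data.List.Relation.Unary.Any using (here; there)
open import Data.List.Relation.Unary.All using (All; []; _∷_)
open import Data.Product using (Σ; _×_; _,_; proj₁)
open import Data.Sum using (_⊎_; inj₁; inj₂)
open import Data.Bool using (true; false)
open import Relation.Nullary using (¬_; yes; no; contradiction)
open import Relation.Binary.PropositionalEquality
  using (_≡_; _≢_; refl; trans; subst; ≢-sym) renaming (sym to ≡-sym)

adjacent-sym : ∀ {n} (G : SimpleGraph n) {x y : Fin n} → Adjacent G x y → Adjacent G y x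
adjacent-sym G {x} {y} a = trans (SimpleGraph.sym G y x) a

adjacent-≢ : ∀ {n} (G : SimpleGraph n) {x y : Fin n} → Adjacent G x y → x ≢ y
adjacent-≢ G {x} a refl with trans (≡-sym a) (irrefl G x)
... | ()

HasNeighbour : ∀ {n} → SimpleGraph n → Fin n → Set
HasNeighbour {n} G u = Σ (Fin n) λ w → Adjacent G u w

walk-neighbour : ∀ {n} (G : SimpleGraph n) {x y : Fin n} → x ≢ y → Walk G x y → HasNeighbour G x
walk-neighbour G x≢y here               = contradiction refl x≢y
walk-neighbour G x≢y (step {y = w} a _) = w , a

SameEdge : ∀ {n} → Fin n → Fin n → Fin n → Fin n → Set
SameEdge u v x y = (u ≡ x × v ≡ y) ⊎ (u ≡ y × v ≡ x)

samePair-sound : ∀ {n} (u v x y : Fin n) → samePair u v x y ≡ true → SameEdge u v x y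
samePair-sound u v x y eq with u ≟ x | v ≟ y | u ≟ y | v ≟ x
samePair-sound u v x y eq | yes p | yes q | _     | _     = inj₁ (p , q)
samePair-sound u v x y eq | yes _ | no _  | yes r | yes s = inj₂ (r , s)
samePair-sound u v x y () | yes _ | no _  | yes _ | no _
samePair-sound u v x y () | yes _ | no _  | no _  | _
samePair-sound u v x y eq | no _  | _     | yes r | yes s = inj₂ (r , s)
samePair-sound u v x y () | no _  | _     | yes _ | no _
samePair-sound u v x y () | no _  | _     | no _  | _

deleteEdge-⊆ : ∀ {n} (G : SimpleGraph n) (u v : Fin n) {x y : Fin n} →
  Adjacent (deleteEdge G u v) x y → Adjacent G x y
deleteEdge-⊆ G u v {x} {y} a with Adj G x y
... | true  = refl
... | false = a

deleteEdge-keeps : ∀ {n} (G : SimpleGraph n) (u v : Fin n) {x y : Fin n} →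
  Adjacent G x y → ¬ SameEdge u v x y → Adjacent (deleteEdge G u v) x y
deleteEdge-keeps G u v {x} {y} a other with samePair u v x y in eq
... | true  = contradiction (samePair-sound u v x y eq) other
... | false rewrite a = refl

ProperAwayFrom : ∀ {n k} → SimpleGraph n → List (Fin n) → (Fin n → Fin k) → Set
ProperAwayFrom G xs c = ∀ x y → x ∉ xs → y ∉ xs → Adjacent G x y → c x ≢ c y

DominatedAwayFrom : ∀ {n k} → SimpleGraph n → List (Fin n) → (Fin n → Fin k) → Set
DominatedAwayFrom {n} {k} G xs c =
  ∀ (i : Fin k) → Σ (Fin n) λ d → ∀ x → x ∉ xs → c x ≡ i → Adjacent G d x

ValidAwayFrom : ∀ {n k} → SimpleGraph n → List (Fin n) → (Fin n → Fin k) → Set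
ValidAwayFrom G xs c = ProperAwayFrom G xs c × DominatedAwayFrom G xs c

valid-dominated : ∀ {n k} (G : SimpleGraph n) (c : Fin n → Fin k) →
  ValidAwayFrom G [] c → DominatedColoring G k
valid-dominated G c (proper , dominated) =
  c , (λ x y → proper x y (λ ()) (λ ())) ,
  (λ i → let d , dom = dominated i in d , λ x → dom x (λ ()))

∉-cons : ∀ {n} {x u : Fin n} {xs : List (Fin n)} → x ≢ u → x ∉ xs → x ∉ u ∷ xs
∉-cons x≢u x∉xs (here x≡u)   = x≢u x≡u
∉-cons x≢u x∉xs (there x∈xs) = x∉xs x∈xs

freshColour : ∀ {n k} → Fin n → (Fin n → Fin k) → Fin n → Fin (suc k)
freshColour u c x with x ≟ u
... | yes _ = zero
... | no _  = suc (c x)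

freshColour-zero : ∀ {n k} (u : Fin n) (c : Fin n → Fin k) {x : Fin n} →
  freshColour u c x ≡ zero → x ≡ u
freshColour-zero u c {x} eq with x ≟ u
... | yes x≡u = x≡u
freshColour-zero u c {x} () | no _

freshColour-suc : ∀ {n k} (u : Fin n) (c : Fin n → Fin k) {x : Fin n} {i : Fin k} →
  freshColour u c x ≡ suc i → x ≢ u × c x ≡ i
freshColour-suc u c {x} eq with x ≟ u
freshColour-suc u c {x} () | yes _
... | no x≢u = x≢u , suc-injective eq

isolate : ∀ {n k} (G : SimpleGraph n) (u : Fin n) (xs : List (Fin n)) (c : Fin n → Fin k) →
  HasNeighbour G u → ValidAwayFrom G (u ∷ xs) c → ValidAwayFrom G xs (freshColour u c)
isolate G u xs c (w , uw) (proper , dominated) = proper′ , dominated′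
  where
  proper′ : ProperAwayFrom G xs (freshColour u c)
  proper′ x y x∉ y∉ xy eq with x ≟ u | y ≟ u
  ... | yes x≡u | yes y≡u = adjacent-≢ G xy (trans x≡u (≡-sym y≡u))
  proper′ x y x∉ y∉ xy () | yes _ | no _
  proper′ x y x∉ y∉ xy () | no _  | yes _
  ... | no x≢u | no y≢u =
    proper x y (∉-cons x≢u x∉) (∉-cons y≢u y∉) xy (suc-injective eq)

  dominated′ : DominatedAwayFrom G xs (freshColour u c)
  dominated′ zero = w , λ x _ eq → subst (Adjacent G w) (≡-sym (freshColour-zero u c eq))
                                          (adjacent-sym G uw)
  dominated′ (suc i) = let d , dom = dominated i in
    d , λ x x∉ eq → let x≢u , cx≡i = freshColour-suc u c eq in dom x (∉-cons x≢u x∉) cx≡i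

isolateAll : ∀ {n k} (G : SimpleGraph n) (xs : List (Fin n)) (c : Fin n → Fin k) →
  All (HasNeighbour G) xs → ValidAwayFrom G xs c → DominatedColoring G (length xs + k)
isolateAll G []       c []              valid = valid-dominated G c valid
isolateAll {k = k} G (u ∷ xs) c (nbr ∷ nbrs) valid =
  subst (DominatedColoring G) (+-suc (length xs) k)
    (isolateAll G xs (freshColour u c) nbrs (isolate G u xs c nbr valid))

valid-after-adding-edge : ∀ {n k} (G : SimpleGraph n) (u v : Fin n) (c : Fin n → Fin k) →
  Proper (deleteEdge G u v) c → AllClassesDominated (deleteEdge G u v) c → ValidAwayFrom G [ u ] c
valid-after-adding-edge G u v c proper dominated = proper′ , dominated′
  where
  proper′ : ProperAwayFrom G [ u ] c
  proper′ x y x∉ y∉ xy = proper x y (deleteEdge-keeps G u v xy avoidsU)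
    where
    avoidsU : ¬ SameEdge u v x y
    avoidsU (inj₁ (u≡x , _)) = x∉ (here (≡-sym u≡x))
    avoidsU (inj₂ (u≡y , _)) = y∉ (here (≡-sym u≡y))

  dominated′ : DominatedAwayFrom G [ u ] c
  dominated′ i = let d , dom = dominated i in
    d , λ x _ cx≡i → deleteEdge-⊆ G u v (dom x cx≡i)

valid-after-deleting-edge : ∀ {n k} (G : SimpleGraph n) (u v : Fin n) (c : Fin n → Fin k) →
  Proper G c → AllClassesDominated G c → ValidAwayFrom (deleteEdge G u v) (u ∷ v ∷ []) c
valid-after-deleting-edge G u v c proper dominated = proper′ , dominated′
  where
  proper′ : ProperAwayFrom (deleteEdge G u v) (u ∷ v ∷ []) c
  proper′ x y _ _ xy = proper x y (deleteEdge-⊆ G u v xy)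

  dominated′ : DominatedAwayFrom (deleteEdge G u v) (u ∷ v ∷ []) c
  dominated′ i = let d , dom = dominated i in
    d , λ x x∉ cx≡i → deleteEdge-keeps G u v (dom x cx≡i) (missesX x∉)
    where
    missesX : ∀ {d x} → x ∉ u ∷ v ∷ [] → ¬ SameEdge u v d x
    missesX x∉ (inj₁ (_ , v≡x)) = x∉ (there (here (≡-sym v≡x)))
    missesX x∉ (inj₂ (u≡x , _)) = x∉ (here (≡-sym u≡x))

domChromatic-≤ : ∀ {n} (G : SimpleGraph n) {m k : ℕ} →
  IsDomChromaticNumber G m → DominatedColoring G k → m ≤ k
domChromatic-≤ G {k = k} (_ , noFewer) coloring = ≮⇒≥ (λ k<m → noFewer k k<m coloring)

mainTheorem1 : ∀ {n} (G : SimpleGraph n) (u v : Fin n) →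
    Connected G → Adjacent G u v → Connected (deleteEdge G u v) →
    ∀ (χG χGe : ℕ) → IsDomChromaticNumber G χG → IsDomChromaticNumber (deleteEdge G u v) χGe →
    (χG ≤ χGe + 1) × (χGe ≤ χG + 2)
mainTheorem1 G u v _ uv connected χG χGe isχG isχGe = lower , upper
  where
  Ge = deleteEdge G u v
  u≢v = adjacent-≢ G uv

  lower : χG ≤ χGe + 1
  lower with proj₁ isχGe
  ... | c , proper , dominated = subst (χG ≤_) (+-comm 1 χGe) (domChromatic-≤ G isχG
          (isolateAll G [ u ] c ((v , uv) ∷ [])
            (valid-after-adding-edge G u v c proper dominated)))

  upper : χGe ≤ χG + 2
  upper with proj₁ isχG
  ... | c , proper , dominated = subst (χGe ≤_) (+-comm 2 χG) (domChromatic-≤ Ge isχGe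
          (isolateAll Ge (u ∷ v ∷ []) c
            (walk-neighbour Ge u≢v (connected u v) ∷
             walk-neighbour Ge (≢-sym u≢v) (connected v u) ∷ [])
            (valid-after-deleting-edge G u v c proper dominated)))
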